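{- Let $p\ge 5$ be a prime and let $r$ be an integer with $1\le r\le p-1$ such that $12r+1$ is a quadratic non-residue modulo $p$. Then for all integers $n\ge 0$ and all integers $k\ge j\ge 0$, \[ a_{p(k-j)+(p-1),\;pk+p}(pn+r)\equiv 0 \pmod p. \]
   Context: For positive integers $r,s$, $a_{r,s}(n)$ denotes the number of multicolored partitions of $n$ in which each even part may appear in one of $r$ colors and each odd part may appear in one of $s$ colors (copies of the same part size in different colors are distinct), with $a_{r,s}(0)=1$. Equivalently, for $|q|<1$, $\sum_{n\ge0}a_{r,s}(n)q^n = f_2^{s-r}/f_1^{s}$, where $f_m=\prod_{i\ge1}(1-q^{mi})$. -}

module Defs where

open import Data.Nat using (ℕ; zero; suc; _+_; _*_; _∸_; _%_; _≤_; NonZero)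
open import Data.Nat.Divisibility using (_∣_)
open import Data.Nat.Primality using (Prime)
open import Data.Product using (_×_)
open import Relation.Nullary using (¬_)
open import Relation.Binary.PropositionalEquality using (_≡_; _≢_)

sumTo : ℕ → (ℕ → ℕ) → ℕ
sumTo zero    f = f 0
sumTo (suc n) f = sumTo n f + f (suc n)

-- number of ways to choose multiplicities (m_1,...,m_c) ∈ ℕ^c with sum t,
-- i.e. the number of multisets of size t from c colours
multisets : ℕ → ℕ → ℕ
multisets zero    zero    = 1
multisets zero    (suc t) = 0
multisets (suc c) t       = sumTo t (λ i → multisets c (t ∸ i))

colours : ℕ → ℕ → ℕ → ℕ
colours r s m with m % 2
... | zero  = r
... | suc _ = s

-- bounded m r s n : number of multicoloured partitions of n with all parts ≤ m
-- (for each part size j, choose a multiset of colours of size t = multiplicity of j).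
mutual
  bounded : ℕ → ℕ → ℕ → ℕ → ℕ
  bounded zero    r s zero    = 1
  bounded zero    r s (suc n) = 0
  bounded (suc m) r s n       = sumTo n (λ t → term m r s n t)

  term : ℕ → ℕ → ℕ → ℕ → ℕ → ℕ
  term m r s n t with t * suc m Data.Nat.≤? n
  ... | Relation.Nullary.yes _ = multisets (colours r s (suc m)) t * bounded m r s (n ∸ t * suc m)
  ... | Relation.Nullary.no  _ = 0

-- a_{r,s}(n): multicoloured partitions of n, each even part in one of r colours,
-- each odd part in one of s colours (parts are ≤ n, so bound m = n suffices)
a : ℕ → ℕ → ℕ → ℕ
a r s n = bounded n r s n

QuadNonResidue : (p : ℕ) → .{{NonZero p}} → ℕ → Set
QuadNonResidue p x = (x % p ≢ 0) × (∀ y → (y * y) % p ≢ x % p)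

{-# OPTIONS --safe #-}
-- Write r + 1 = pα and s = pβ (here α = k - j + 1 and β = k + 1). The generating function
-- ∏ᵢ (1 - qⁱ)^(-cᵢ) of a_{r,s} then has the factor (1 - qⁱ)^(-pβ) for odd i and
-- (1 - qⁱ) (1 - qⁱ)^(-pα) for even i. The coefficients of (1 - x)^(-pc) off the multiples of p
-- are divisible by p, so the product G of all the factors (1 - qⁱ)^(-pc) is ≡ g(qᵖ) (mod p),
-- and the generating function is G · F with F = (q²; q²)_∞. By Euler's pentagonal number theorem
-- the coefficient of qᵉ in F vanishes unless 12e + 1 is a square. In the coefficient of
-- q^(pn+r) every product of coefficients Gᵢ F_{pn+r-i} with p ∤ i is divisible by p, and when
-- p ∣ i we have 12(pn + r - i) + 1 ≡ 12r + 1, a non-residue, so F_{pn+r-i} = 0.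
--
-- Everything is done for partitions into parts ≤ m, with the finite product (q²; q²)_⌊m/2⌋,
-- for which Euler's theorem holds in low degrees by Shanks' identity, proved by telescoping.
module Submission where

open import Defs
open import Data.Nat using (ℕ; _+_; _*_; _∸_; _≤_; _%_; NonZero)
open import Data.Nat.Divisibility using (_∣_)
open import Data.Nat.Primality using (Prime)

open import Algebra.Bundles using (CommutativeMonoid; CommutativeRing)
open import Algebra.Structures using (IsCommutativeRing)
import Algebra.Solver.Ring.AlmostCommutativeRing as ACR
open import Data.Integer using (ℤ; +_; -_; 0ℤ; 1ℤ; -1ℤ) renaming (_+_ to _+ᶻ_; _*_ to _*ᶻ_)
import Data.Integer.Base as ℤ
import Data.Integer.Properties as ℤ
import Data.Integer.Divisibility.Signed as ℤ∣
open ℤ∣ using () renaming (_∣_ to _∣ᶻ_)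
open import Data.Integer.Tactic.RingSolver using (solve-∀)
open import Data.Maybe using (Maybe; just; nothing)
open import Data.Nat using (zero; suc; _<_; z≤n; s≤s; >-nonZero⁻¹)
import Data.Nat.Properties as ℕ
open import Data.Nat.Divisibility
  using ( _∣?_; _∤_; divides; quotient; _∣0; n∣m*n; m∣m*n; ∣m⇒∣m*n; ∣m∣n⇒∣m+n; ∣m+n∣m⇒∣n
        ; ∣-refl; ∣⇒≤ )
open import Data.Nat.DivMod using ([m+kn]%n≡m%n; m*n%n≡0)
open import Data.Nat.Induction using (<-rec)
open import Data.Nat.Primality using (euclidsLemma)
open import Data.Nat.Tactic.RingSolver using () renaming (solve-∀ to ℕ-solve-∀)
open import Data.Product using (Σ-syntax; _×_; _,_)
open import Data.Sum using (_⊎_; inj₁; inj₂)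
open import Function using (_∘_)
open import Level using (0ℓ)
import Relation.Binary.PropositionalEquality as ≡
import Relation.Binary.Reasoning.Setoid as SetoidReasoning
open import Relation.Binary.Structures using (IsEquivalence)
open import Relation.Nullary using (Dec; yes; no; contradiction)

module FiniteSum {c ℓ} (M : CommutativeMonoid c ℓ) where
  open CommutativeMonoid M

  ∑≤ : ℕ → (ℕ → Carrier) → Carrier
  ∑≤ zero    f = f 0
  ∑≤ (suc n) f = ∑≤ n f ∙ f (suc n)

  ∑≤-cong : ∀ n {f g} → (∀ i → i ≤ n → f i ≈ g i) → ∑≤ n f ≈ ∑≤ n g
  ∑≤-cong zero    f≈g = f≈g 0 z≤n
  ∑≤-cong (suc n) f≈g =
    ∙-cong (∑≤-cong n (λ i i≤n → f≈g i (ℕ.m≤n⇒m≤1+n i≤n))) (f≈g (suc n) ℕ.≤-refl)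

  ∑≤-unfoldˡ : ∀ n f → ∑≤ (suc n) f ≈ f 0 ∙ ∑≤ n (λ i → f (suc i))
  ∑≤-unfoldˡ zero    f = refl
  ∑≤-unfoldˡ (suc n) f = trans (∙-cong (∑≤-unfoldˡ n f) refl) (assoc _ _ _)

  ∑≤-ε : ∀ n {f} → (∀ i → i ≤ n → f i ≈ ε) → ∑≤ n f ≈ ε
  ∑≤-ε zero    f≈ε = f≈ε 0 z≤n
  ∑≤-ε (suc n) f≈ε = trans
    (∙-cong (∑≤-ε n (λ i i≤n → f≈ε i (ℕ.m≤n⇒m≤1+n i≤n))) (f≈ε (suc n) ℕ.≤-refl))
    (identityˡ ε)

  ∑≤-extend : ∀ m w {f} → (∀ i → m < i → f i ≈ ε) → ∑≤ (m + w) f ≈ ∑≤ m f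
  ∑≤-extend m zero    {f} f≈ε = reflexive (≡.cong (λ k → ∑≤ k f) (ℕ.+-identityʳ m))
  ∑≤-extend m (suc w) {f} f≈ε = begin
    ∑≤ (m + suc w) f             ≡⟨ ≡.cong (λ k → ∑≤ k f) (ℕ.+-suc m w) ⟩
    ∑≤ (m + w) f ∙ f (suc m + w) ≈⟨ ∙-cong (∑≤-extend m w f≈ε) (f≈ε _ (s≤s (ℕ.m≤m+n m w))) ⟩
    ∑≤ m f ∙ ε                   ≈⟨ identityʳ _ ⟩
    ∑≤ m f                       ∎
    where open SetoidReasoning setoid

open FiniteSum ℤ.+-0-commutativeMonoid
open ≡

-- Power series over ℤ

Series : Set
Series = ℕ → ℤ

infix  4 _≈ₛ_
infixl 6 _+ₛ_ _-ₛ_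
infixl 7 _*ₛ_ _·ₛ_
infix  8 -ₛ_

record _≈ₛ_ (f g : Series) : Set where
  constructor coeffwise
  field coeff : ∀ n → f n ≡ g n
open _≈ₛ_

tail : Series → Series
tail f n = f (suc n)

0ₛ 1ₛ : Series
0ₛ n = 0ℤ
1ₛ zero    = 1ℤ
1ₛ (suc n) = 0ℤ

_+ₛ_ : Series → Series → Series
(f +ₛ g) n = f n +ᶻ g n

-ₛ_ : Series → Series
(-ₛ f) n = - f n

_-ₛ_ : Series → Series → Series
f -ₛ g = f +ₛ -ₛ g

_·ₛ_ : ℤ → Series → Series
(c ·ₛ f) n = c *ᶻ f n

-- f g = f₀ g + q (tail f) g rather than a convolution, so that the ring laws follow by induction
-- on the degree; *ₛ-coeff recovers the convolution.
_*ₛ_ : Series → Series → Series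
(f *ₛ g) zero    = f 0 *ᶻ g 0
(f *ₛ g) (suc n) = f 0 *ᶻ g (suc n) +ᶻ (tail f *ₛ g) n

*ₛ-cong-at : ∀ n {f f′ g g′} → (∀ i → f i ≡ f′ i) → (∀ i → g i ≡ g′ i) →
             (f *ₛ g) n ≡ (f′ *ₛ g′) n
*ₛ-cong-at zero    f≡ g≡ = cong₂ _*ᶻ_ (f≡ 0) (g≡ 0)
*ₛ-cong-at (suc n) f≡ g≡ =
  cong₂ _+ᶻ_ (cong₂ _*ᶻ_ (f≡ 0) (g≡ (suc n))) (*ₛ-cong-at n (λ i → f≡ (suc i)) g≡)

*ₛ-zeroˡ-at : ∀ n g → (0ₛ *ₛ g) n ≡ 0ℤ
*ₛ-zeroˡ-at zero    g = refl
*ₛ-zeroˡ-at (suc n) g = cong (0ℤ +ᶻ_) (*ₛ-zeroˡ-at n g)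

*ₛ-identityˡ-at : ∀ n g → (1ₛ *ₛ g) n ≡ g n
*ₛ-identityˡ-at zero    g = ℤ.*-identityˡ (g 0)
*ₛ-identityˡ-at (suc n) g rewrite *ₛ-zeroˡ-at n g =
  trans (ℤ.+-identityʳ _) (ℤ.*-identityˡ (g (suc n)))

*ₛ-distribʳ-at : ∀ n f g h → ((f +ₛ g) *ₛ h) n ≡ (f *ₛ h) n +ᶻ (g *ₛ h) n
*ₛ-distribʳ-at zero    f g h = ℤ.*-distribʳ-+ (h 0) (f 0) (g 0)
*ₛ-distribʳ-at (suc n) f g h rewrite *ₛ-distribʳ-at n (tail f) (tail g) h =
  rearrange (f 0) (g 0) (h (suc n)) ((tail f *ₛ h) n) ((tail g *ₛ h) n)
  where
  rearrange : ∀ a b c x y → (a +ᶻ b) *ᶻ c +ᶻ (x +ᶻ y) ≡ (a *ᶻ c +ᶻ x) +ᶻ (b *ᶻ c +ᶻ y)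
  rearrange = solve-∀

*ₛ-distribˡ-at : ∀ n f g h → (f *ₛ (g +ₛ h)) n ≡ (f *ₛ g) n +ᶻ (f *ₛ h) n
*ₛ-distribˡ-at zero    f g h = ℤ.*-distribˡ-+ (f 0) (g 0) (h 0)
*ₛ-distribˡ-at (suc n) f g h rewrite *ₛ-distribˡ-at n (tail f) g h =
  rearrange (f 0) (g (suc n)) (h (suc n)) ((tail f *ₛ g) n) ((tail f *ₛ h) n)
  where
  rearrange : ∀ a b c x y → a *ᶻ (b +ᶻ c) +ᶻ (x +ᶻ y) ≡ (a *ᶻ b +ᶻ x) +ᶻ (a *ᶻ c +ᶻ y)
  rearrange = solve-∀

*ₛ-scaleˡ-at : ∀ n c f g → ((c ·ₛ f) *ₛ g) n ≡ c *ᶻ (f *ₛ g) n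
*ₛ-scaleˡ-at zero    c f g = ℤ.*-assoc c (f 0) (g 0)
*ₛ-scaleˡ-at (suc n) c f g rewrite *ₛ-scaleˡ-at n c (tail f) g =
  rearrange c (f 0) (g (suc n)) ((tail f *ₛ g) n)
  where
  rearrange : ∀ c a b x → c *ᶻ a *ᶻ b +ᶻ c *ᶻ x ≡ c *ᶻ (a *ᶻ b +ᶻ x)
  rearrange = solve-∀

*ₛ-assoc-at : ∀ n f g h → ((f *ₛ g) *ₛ h) n ≡ (f *ₛ (g *ₛ h)) n
*ₛ-assoc-at zero    f g h = ℤ.*-assoc (f 0) (g 0) (h 0)
*ₛ-assoc-at (suc n) f g h
  rewrite *ₛ-distribʳ-at n (f 0 ·ₛ tail g) (tail f *ₛ g) h
        | *ₛ-scaleˡ-at n (f 0) (tail g) h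
        | *ₛ-assoc-at n (tail f) g h =
  rearrange (f 0) (g 0) (h (suc n)) ((tail g *ₛ h) n) ((tail f *ₛ (g *ₛ h)) n)
  where
  rearrange : ∀ a b c x y → a *ᶻ b *ᶻ c +ᶻ (a *ᶻ x +ᶻ y) ≡ a *ᶻ (b *ᶻ c +ᶻ x) +ᶻ y
  rearrange = solve-∀

*ₛ-comm-at : ∀ n f g → (f *ₛ g) n ≡ (g *ₛ f) n
*ₛ-comm-at zero          f g = ℤ.*-comm (f 0) (g 0)
*ₛ-comm-at (suc zero)    f g = rearrange (f 0) (g 1) (f 1) (g 0)
  where
  rearrange : ∀ a b c d → a *ᶻ b +ᶻ c *ᶻ d ≡ d *ᶻ c +ᶻ b *ᶻ a
  rearrange = solve-∀
*ₛ-comm-at (suc (suc n)) f g = begin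
  f 0 *ᶻ g (2 + n) +ᶻ (tail f *ₛ g) (suc n)
    ≡⟨ cong (f 0 *ᶻ g (2 + n) +ᶻ_) (*ₛ-comm-at (suc n) (tail f) g) ⟩
  f 0 *ᶻ g (2 + n) +ᶻ (g 0 *ᶻ f (2 + n) +ᶻ (tail g *ₛ tail f) n)
    ≡⟨ cong (λ x → f 0 *ᶻ g (2 + n) +ᶻ (g 0 *ᶻ f (2 + n) +ᶻ x)) (*ₛ-comm-at n (tail g) (tail f)) ⟩
  f 0 *ᶻ g (2 + n) +ᶻ (g 0 *ᶻ f (2 + n) +ᶻ (tail f *ₛ tail g) n)
    ≡⟨ rearrange (f 0 *ᶻ g (2 + n)) (g 0 *ᶻ f (2 + n)) ((tail f *ₛ tail g) n) ⟩
  g 0 *ᶻ f (2 + n) +ᶻ (f 0 *ᶻ g (2 + n) +ᶻ (tail f *ₛ tail g) n)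
    ≡⟨ cong (g 0 *ᶻ f (2 + n) +ᶻ_) (*ₛ-comm-at (suc n) (tail g) f) ⟨
  g 0 *ᶻ f (2 + n) +ᶻ (tail g *ₛ f) (suc n) ∎
  where
  open ≡-Reasoning
  rearrange : ∀ a b x → a +ᶻ (b +ᶻ x) ≡ b +ᶻ (a +ᶻ x)
  rearrange = solve-∀

*ₛ-identityʳ-at : ∀ n f → (f *ₛ 1ₛ) n ≡ f n
*ₛ-identityʳ-at n f = trans (*ₛ-comm-at n f 1ₛ) (*ₛ-identityˡ-at n f)

≈ₛ-isEquivalence : IsEquivalence _≈ₛ_
≈ₛ-isEquivalence = record
  { refl  = coeffwise (λ _ → refl)
  ; sym   = λ f≈g → coeffwise (λ n → sym (coeff f≈g n))
  ; trans = λ f≈g g≈h → coeffwise (λ n → trans (coeff f≈g n) (coeff g≈h n))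
  }

series-isCommutativeRing : IsCommutativeRing _≈ₛ_ _+ₛ_ _*ₛ_ -ₛ_ 0ₛ 1ₛ
series-isCommutativeRing = record
  { isRing = record
    { +-isAbelianGroup = record
      { isGroup = record
        { isMonoid = record
          { isSemigroup = record
            { isMagma = record
              { isEquivalence = ≈ₛ-isEquivalence
              ; ∙-cong = λ f≈ g≈ → coeffwise (λ n → cong₂ _+ᶻ_ (coeff f≈ n) (coeff g≈ n)) }
            ; assoc = λ f g h → coeffwise (λ n → ℤ.+-assoc (f n) (g n) (h n)) }
          ; identity = (λ f → coeffwise (λ n → ℤ.+-identityˡ (f n)))
                     , (λ f → coeffwise (λ n → ℤ.+-identityʳ (f n))) }
        ; inverse = (λ f → coeffwise (λ n → ℤ.+-inverseˡ (f n)))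
                  , (λ f → coeffwise (λ n → ℤ.+-inverseʳ (f n)))
        ; ⁻¹-cong = λ f≈ → coeffwise (λ n → cong -_ (coeff f≈ n)) }
      ; comm = λ f g → coeffwise (λ n → ℤ.+-comm (f n) (g n)) }
    ; *-cong = λ f≈ g≈ → coeffwise (λ n → *ₛ-cong-at n (coeff f≈) (coeff g≈))
    ; *-assoc = λ f g h → coeffwise (λ n → *ₛ-assoc-at n f g h)
    ; *-identity = (λ g → coeffwise (λ n → *ₛ-identityˡ-at n g))
                 , (λ g → coeffwise (λ n → *ₛ-identityʳ-at n g))
    ; distrib = (λ f g h → coeffwise (λ n → *ₛ-distribˡ-at n f g h))
              , (λ f g h → coeffwise (λ n → *ₛ-distribʳ-at n g h f)) }
  ; *-comm = λ f g → coeffwise (λ n → *ₛ-comm-at n f g) }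

series-commutativeRing : CommutativeRing 0ℓ 0ℓ
series-commutativeRing = record { isCommutativeRing = series-isCommutativeRing }

open CommutativeRing series-commutativeRing
  using ( +-cong; *-cong; -‿cong; -‿inverseʳ; *-comm; *-assoc; *-identityˡ; *-identityʳ
        ; distribˡ; distribʳ; zeroʳ )
  renaming ( setoid to ≈ₛ-setoid; refl to ≈ₛ-refl; sym to ≈ₛ-sym; trans to ≈ₛ-trans
           ; reflexive to ≈ₛ-reflexive )
open import Algebra.Properties.Ring (CommutativeRing.ring series-commutativeRing)
  using (-‿distribˡ-*; -‿distribʳ-*)

module ≈ₛ-Reasoning = SetoidReasoning ≈ₛ-setoid

-- ℤ acts through constₛ as the coefficient ring of the ring solver.
constₛ : ℤ → Series
constₛ c = c ·ₛ 1ₛ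

*ₛ-constˡ-at : ∀ n c g → (constₛ c *ₛ g) n ≡ c *ᶻ g n
*ₛ-constˡ-at n c g = trans (*ₛ-scaleˡ-at n c 1ₛ g) (cong (c *ᶻ_) (*ₛ-identityˡ-at n g))

series-almostCommutativeRing : ACR.AlmostCommutativeRing 0ℓ 0ℓ
series-almostCommutativeRing = ACR.fromCommutativeRing series-commutativeRing

constₛ-homomorphism : ℤ.+-*-rawRing ACR.-Raw-AlmostCommutative⟶ series-almostCommutativeRing
constₛ-homomorphism = record
  { ⟦_⟧    = constₛ
  ; +-homo = λ a b → coeffwise (λ n → ℤ.*-distribʳ-+ (1ₛ n) a b)
  ; *-homo = λ a b → coeffwise (λ n →
               trans (ℤ.*-assoc a b (1ₛ n)) (sym (*ₛ-constˡ-at n a (constₛ b))))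
  ; -‿homo = λ a → coeffwise (λ n → sym (ℤ.neg-distribˡ-* a (1ₛ n)))
  ; 0-homo = coeffwise (λ n → refl)
  ; 1-homo = coeffwise (λ n → ℤ.*-identityˡ (1ₛ n))
  }

constₛ-≟ : (a b : ℤ) → Maybe (constₛ a ≈ₛ constₛ b)
constₛ-≟ a b with a ℤ.≟ b
... | yes refl = just ≈ₛ-refl
... | no _     = nothing

open import Algebra.Solver.Ring ℤ.+-*-rawRing series-almostCommutativeRing constₛ-homomorphism constₛ-≟
  using (solve; _:=_; _:+_; _:-_; _:*_; :-_)

*ₛ-coeff : ∀ n f g → (f *ₛ g) n ≡ ∑≤ n (λ i → f i *ᶻ g (n ∸ i))
*ₛ-coeff zero    f g = refl
*ₛ-coeff (suc n) f g =
  trans (cong (f 0 *ᶻ g (suc n) +ᶻ_) (*ₛ-coeff n (tail f) g))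
        (sym (∑≤-unfoldˡ n (λ i → f i *ᶻ g (suc n ∸ i))))

shift : ℕ → Series → Series
shift zero    f n       = f n
shift (suc e) f zero    = 0ℤ
shift (suc e) f (suc n) = shift e f n

shift-at-+ : ∀ e w f → shift e f (e + w) ≡ f w
shift-at-+ zero    w f = refl
shift-at-+ (suc e) w f = shift-at-+ e w f

shift-below : ∀ e {n} f → n < e → shift e f n ≡ 0ℤ
shift-below (suc e) {zero}  f _         = refl
shift-below (suc e) {suc n} f (s≤s n<e) = shift-below e f n<e

shift-cong≤ : ∀ e n {f g} → (∀ i → i ≤ n → f i ≡ g i) → shift e f n ≡ shift e g n
shift-cong≤ zero    n       f≡g = f≡g n ℕ.≤-refl
shift-cong≤ (suc e) zero    f≡g = refl
shift-cong≤ (suc e) (suc n) f≡g = shift-cong≤ e n (λ i i≤n → f≡g i (ℕ.m≤n⇒m≤1+n i≤n))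

shift-cong< : ∀ e .{{_ : NonZero e}} n {f g} → (∀ i → i < n → f i ≡ g i) → shift e f n ≡ shift e g n
shift-cong< (suc e) zero    f≡g = refl
shift-cong< (suc e) (suc n) f≡g = shift-cong≤ e n (λ i i≤n → f≡g i (s≤s i≤n))

shift-shift : ∀ a b f → shift a (shift b f) ≈ₛ shift (a + b) f
shift-shift a b f = coeffwise (go a)
  where
  go : ∀ a n → shift a (shift b f) n ≡ shift (a + b) f n
  go zero    n       = refl
  go (suc a) zero    = refl
  go (suc a) (suc n) = go a n

*ₛ-shiftˡ : ∀ e f g → shift e f *ₛ g ≈ₛ shift e (f *ₛ g)
*ₛ-shiftˡ e f g = coeffwise (go e f)
  where
  go : ∀ e f n → (shift e f *ₛ g) n ≡ shift e (f *ₛ g) n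
  go zero    f n       = refl
  go (suc e) f zero    = refl
  go (suc e) f (suc n) = trans (ℤ.+-identityˡ _) (go e f n)

*ₛ-unfoldˡ : ∀ f g → f *ₛ g ≈ₛ f 0 ·ₛ g +ₛ shift 1 (tail f *ₛ g)
*ₛ-unfoldˡ f g = coeffwise λ
  { zero    → sym (ℤ.+-identityʳ _)
  ; (suc n) → refl }

infix 9 q^_
q^_ : ℕ → Series
q^ e = shift e 1ₛ

q^-*ₛ : ∀ e g → q^ e *ₛ g ≈ₛ shift e g
q^-*ₛ e g = ≈ₛ-trans (*ₛ-shiftˡ e 1ₛ g)
  (coeffwise (λ n → shift-cong≤ e n (λ i _ → *ₛ-identityˡ-at i g)))

q^-+ : ∀ a b → q^ a *ₛ q^ b ≈ₛ q^ (a + b)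
q^-+ a b = ≈ₛ-trans (q^-*ₛ a (q^ b)) (shift-shift a b 1ₛ)

q^-at : ∀ e → (q^ e) e ≡ 1ℤ
q^-at zero    = refl
q^-at (suc e) = q^-at e

q^-≢ : ∀ {e n} → e ≢ n → (q^ e) n ≡ 0ℤ
q^-≢ {zero}  {zero}  e≢n = contradiction refl e≢n
q^-≢ {zero}  {suc n} e≢n = refl
q^-≢ {suc e} {zero}  e≢n = refl
q^-≢ {suc e} {suc n} e≢n = q^-≢ (e≢n ∘ cong suc)

q^-*ₛ-below : ∀ e g {n} → n < e → (q^ e *ₛ g) n ≡ 0ℤ
q^-*ₛ-below e g n<e = trans (coeff (q^-*ₛ e g) _) (shift-below e g n<e)

-- The recursion determines F e in degree n from F (tail e) in degrees < n, as d > 0.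
shift-recursion-unique : ∀ d .{{_ : NonZero d}} (A F G : Series → Series) →
  (∀ e → F e ≈ₛ A e +ₛ shift d (F (tail e))) →
  (∀ e → G e ≈ₛ A e +ₛ shift d (G (tail e))) →
  ∀ e → F e ≈ₛ G e
shift-recursion-unique d A F G F-rec G-rec e = coeffwise (λ n → <-rec P agree n e)
  where
  P : ℕ → Set
  P n = ∀ e → F e n ≡ G e n
  agree : ∀ n → (∀ {i} → i < n → P i) → P n
  agree n below e = begin
    F e n                           ≡⟨ coeff (F-rec e) n ⟩
    A e n +ᶻ shift d (F (tail e)) n ≡⟨ cong (A e n +ᶻ_) (shift-cong< d n (λ i i<n → below i<n (tail e))) ⟩
    A e n +ᶻ shift d (G (tail e)) n ≡⟨ coeff (G-rec e) n ⟨
    G e n                           ∎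
    where open ≡-Reasoning

-- Dilation

-- dilate d f = f(q^d)
dilate : ℕ → Series → Series
dilate d f n with d ∣? n
... | yes d∣n = f (quotient d∣n)
... | no  _   = 0ℤ

module _ {d : ℕ} .{{_ : NonZero d}} where

  dilate-∣ : ∀ f t → dilate d f (t * d) ≡ f t
  dilate-∣ f t with d ∣? t * d
  ... | yes (divides t′ eq) = cong f (sym (ℕ.*-cancelʳ-≡ t t′ d eq))
  ... | no  d∤td            = contradiction (n∣m*n t) d∤td

  dilate-∤ : ∀ f {n} → d ∤ n → dilate d f n ≡ 0ℤ
  dilate-∤ f {n} d∤n with d ∣? n
  ... | yes d∣n = contradiction d∣n d∤n
  ... | no  _   = refl

  dilate-cong : ∀ {f g} → f ≈ₛ g → dilate d f ≈ₛ dilate d g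
  dilate-cong {f} {g} f≈g = coeffwise go
    where
    go : ∀ n → dilate d f n ≡ dilate d g n
    go n with d ∣? n
    ... | yes d∣n = coeff f≈g (quotient d∣n)
    ... | no  _   = refl

  dilate-pointwise : ∀ (φ : ℤ → ℤ → ℤ) → φ 0ℤ 0ℤ ≡ 0ℤ → ∀ f g →
    dilate d (λ n → φ (f n) (g n)) ≈ₛ (λ n → φ (dilate d f n) (dilate d g n))
  dilate-pointwise φ φ00≡0 f g = coeffwise go
    where
    go : ∀ n → dilate d (λ n → φ (f n) (g n)) n ≡ φ (dilate d f n) (dilate d g n)
    go n with d ∣? n
    ... | yes _ = refl
    ... | no  _ = sym φ00≡0

  dilate-+ₛ : ∀ f g → dilate d (f +ₛ g) ≈ₛ dilate d f +ₛ dilate d g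
  dilate-+ₛ = dilate-pointwise _+ᶻ_ refl

  dilate-negₛ : ∀ f → dilate d (-ₛ f) ≈ₛ -ₛ dilate d f
  dilate-negₛ f = dilate-pointwise (λ x _ → - x) refl f f

  dilate-·ₛ : ∀ c f → dilate d (c ·ₛ f) ≈ₛ c ·ₛ dilate d f
  dilate-·ₛ c f = dilate-pointwise (λ x _ → c *ᶻ x) (ℤ.*-zeroʳ c) f f

  dilate-at-+ : ∀ f w → dilate d f (d + w) ≡ dilate d (tail f) w
  dilate-at-+ f w = by-cases (d ∣? w)
    where
    by-cases : Dec (d ∣ w) → dilate d f (d + w) ≡ dilate d (tail f) w
    by-cases (yes (divides t w≡td)) =
      subst (λ m → dilate d f (d + m) ≡ dilate d (tail f) m) (sym w≡td)
            (trans (dilate-∣ f (suc t)) (sym (dilate-∣ (tail f) t)))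
    by-cases (no d∤w) = trans (dilate-∤ f (λ d∣d+w → d∤w (∣m+n∣m⇒∣n d∣d+w ∣-refl)))
                              (sym (dilate-∤ (tail f) d∤w))

  dilate-unfold : ∀ f → dilate d f ≈ₛ f 0 ·ₛ 1ₛ +ₛ shift d (dilate d (tail f))
  dilate-unfold f = coeffwise go
    where
    positive : ∀ n → dilate d f (suc n) ≡ shift d (dilate d (tail f)) (suc n)
    positive n with d ℕ.≤? suc n
    ... | no  d≰1+n = trans (dilate-∤ f (d≰1+n ∘ ∣⇒≤)) (sym (shift-below d _ (ℕ.≰⇒> d≰1+n)))
    ... | yes d≤1+n = subst (λ m → dilate d f m ≡ shift d (dilate d (tail f)) m) (ℕ.m+[n∸m]≡n d≤1+n)
                        (trans (dilate-at-+ f (suc n ∸ d)) (sym (shift-at-+ d (suc n ∸ d) _)))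
    go : ∀ n → dilate d f n ≡ f 0 *ᶻ 1ₛ n +ᶻ shift d (dilate d (tail f)) n
    go zero    = trans (dilate-∣ f 0) (sym (trans
      (cong₂ _+ᶻ_ (ℤ.*-identityʳ (f 0)) (shift-below d _ (>-nonZero⁻¹ d))) (ℤ.+-identityʳ (f 0))))
    go (suc n) = trans (positive n) (sym (trans
      (cong (_+ᶻ shift d (dilate d (tail f)) (suc n)) (ℤ.*-zeroʳ (f 0))) (ℤ.+-identityˡ _)))

  dilate-shift₁ : ∀ f → dilate d (shift 1 f) ≈ₛ shift d (dilate d f)
  dilate-shift₁ f = ≈ₛ-trans (dilate-unfold (shift 1 f)) (coeffwise (λ n →
    trans (cong (_+ᶻ shift d (dilate d f) n) (ℤ.*-zeroˡ (1ₛ n))) (ℤ.+-identityˡ _)))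

  dilate-*ₛ-unfold : ∀ f h → dilate d f *ₛ h ≈ₛ f 0 ·ₛ h +ₛ shift d (dilate d (tail f) *ₛ h)
  dilate-*ₛ-unfold f h = begin
    dilate d f *ₛ h                                         ≈⟨ *-cong (dilate-unfold f) ≈ₛ-refl ⟩
    (f 0 ·ₛ 1ₛ +ₛ shift d (dilate d (tail f))) *ₛ h        ≈⟨ distribʳ h _ _ ⟩
    (f 0 ·ₛ 1ₛ) *ₛ h +ₛ shift d (dilate d (tail f)) *ₛ h   ≈⟨ +-cong (coeffwise (λ n → *ₛ-constˡ-at n (f 0) h))
                                                                      (*ₛ-shiftˡ d _ h) ⟩
    f 0 ·ₛ h +ₛ shift d (dilate d (tail f) *ₛ h)           ∎
    where open ≈ₛ-Reasoning

  dilate-*ₛ : ∀ f g → dilate d (f *ₛ g) ≈ₛ dilate d f *ₛ dilate d g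
  dilate-*ₛ f g = shift-recursion-unique d (λ f → f 0 ·ₛ dilate d g)
    (λ f → dilate d (f *ₛ g)) (λ f → dilate d f *ₛ dilate d g)
    product-unfold (λ f → dilate-*ₛ-unfold f _) f
    where
    open ≈ₛ-Reasoning
    product-unfold : ∀ f → dilate d (f *ₛ g) ≈ₛ f 0 ·ₛ dilate d g +ₛ shift d (dilate d (tail f *ₛ g))
    product-unfold f = begin
      dilate d (f *ₛ g)                                          ≈⟨ dilate-cong (*ₛ-unfoldˡ f g) ⟩
      dilate d (f 0 ·ₛ g +ₛ shift 1 (tail f *ₛ g))               ≈⟨ dilate-+ₛ _ _ ⟩
      dilate d (f 0 ·ₛ g) +ₛ dilate d (shift 1 (tail f *ₛ g))    ≈⟨ +-cong (dilate-·ₛ (f 0) g) (dilate-shift₁ _) ⟩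
      f 0 ·ₛ dilate d g +ₛ shift d (dilate d (tail f *ₛ g))      ∎

  dilate-q^ : ∀ i → dilate d (q^ i) ≈ₛ q^ (i * d)
  dilate-q^ i = coeffwise (λ n → by-cases n (d ∣? n))
    where
    at-multiple : ∀ t → (q^ i) t ≡ (q^ (i * d)) (t * d)
    at-multiple t with i ℕ.≟ t
    ... | yes refl = trans (q^-at i) (sym (q^-at (i * d)))
    ... | no  i≢t  = trans (q^-≢ i≢t) (sym (q^-≢ (i≢t ∘ ℕ.*-cancelʳ-≡ i t d)))
    by-cases : ∀ n → Dec (d ∣ n) → dilate d (q^ i) n ≡ (q^ (i * d)) n
    by-cases n (yes (divides t n≡td)) = subst (λ m → dilate d (q^ i) m ≡ (q^ (i * d)) m) (sym n≡td)
      (trans (dilate-∣ (q^ i) t) (at-multiple t))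
    by-cases n (no d∤n) =
      trans (dilate-∤ (q^ i) d∤n) (sym (q^-≢ (λ id≡n → d∤n (divides i (sym id≡n)))))

  dilate-1-q^ : ∀ i → dilate d (1ₛ -ₛ q^ i) ≈ₛ 1ₛ -ₛ q^ (i * d)
  dilate-1-q^ i = ≈ₛ-trans (dilate-+ₛ 1ₛ (-ₛ q^ i))
    (+-cong (dilate-q^ 0) (≈ₛ-trans (dilate-negₛ (q^ i)) (-‿cong (dilate-q^ i))))

-- Partitions into bounded parts

-- Defs.term, for an arbitrary part size d and arbitrary series e and X.
sparseTerm : ℕ → Series → Series → ℕ → ℕ → ℤ
sparseTerm d e X n t with t * d ℕ.≤? n
... | yes _ = e t *ᶻ X (n ∸ t * d)
... | no  _ = 0ℤ

sparseConv : ℕ → Series → Series → Series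
sparseConv d e X n = ∑≤ n (sparseTerm d e X n)

sparseTerm-≤ : ∀ d e X {n} t → t * d ≤ n → sparseTerm d e X n t ≡ e t *ᶻ X (n ∸ t * d)
sparseTerm-≤ d e X {n} t td≤n with t * d ℕ.≤? n
... | yes _    = refl
... | no  td≰n = contradiction td≤n td≰n

sparseTerm-> : ∀ d e X {n} t → n < t * d → sparseTerm d e X n t ≡ 0ℤ
sparseTerm-> d e X {n} t n<td with t * d ℕ.≤? n
... | yes td≤n = contradiction td≤n (ℕ.<⇒≱ n<td)
... | no  _    = refl

sparseTerm-suc : ∀ k e X w t →
  sparseTerm (suc k) e X (suc k + w) (suc t) ≡ sparseTerm (suc k) (tail e) X w t
sparseTerm-suc k e X w t = by-cases (t * suc k ℕ.≤? w)
  where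
  by-cases : Dec (t * suc k ≤ w) →
             sparseTerm (suc k) e X (suc k + w) (suc t) ≡ sparseTerm (suc k) (tail e) X w t
  by-cases (yes td≤w) =
    trans (sparseTerm-≤ (suc k) e X (suc t) (ℕ.+-monoʳ-≤ (suc k) td≤w))
      (trans (cong (λ m → e (suc t) *ᶻ X m) (ℕ.[m+n]∸[m+o]≡n∸o (suc k) w (t * suc k)))
             (sym (sparseTerm-≤ (suc k) (tail e) X t td≤w)))
  by-cases (no td≰w) =
    trans (sparseTerm-> (suc k) e X (suc t) (ℕ.+-monoʳ-< (suc k) (ℕ.≰⇒> td≰w)))
          (sym (sparseTerm-> (suc k) (tail e) X t (ℕ.≰⇒> td≰w)))

sparseConv-unfold : ∀ k e X →
  sparseConv (suc k) e X ≈ₛ e 0 ·ₛ X +ₛ shift (suc k) (sparseConv (suc k) (tail e) X)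
sparseConv-unfold k e X = coeffwise go
  where
  d = suc k
  beyond : ∀ w → ∑≤ (k + w) (λ t → sparseTerm d e X (d + w) (suc t)) ≡ sparseConv d (tail e) X w
  beyond w = begin
    ∑≤ (k + w) (λ t → sparseTerm d e X (d + w) (suc t))
      ≡⟨ ∑≤-cong (k + w) (λ t _ → sparseTerm-suc k e X w t) ⟩
    ∑≤ (k + w) (sparseTerm d (tail e) X w)
      ≡⟨ cong (λ m → ∑≤ m (sparseTerm d (tail e) X w)) (ℕ.+-comm k w) ⟩
    ∑≤ (w + k) (sparseTerm d (tail e) X w)
      ≡⟨ ∑≤-extend w k (λ t w<t → sparseTerm-> d (tail e) X t (ℕ.<-≤-trans w<t (ℕ.m≤m*n t d))) ⟩
    sparseConv d (tail e) X w ∎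
    where open ≡-Reasoning
  higher : ∀ n → ∑≤ n (λ t → sparseTerm d e X (suc n) (suc t)) ≡ shift k (sparseConv d (tail e) X) n
  higher n with k ℕ.≤? n
  ... | no  k≰n = trans
    (∑≤-ε n (λ t _ → sparseTerm-> d e X (suc t) (s≤s (ℕ.<-≤-trans (ℕ.≰⇒> k≰n) (ℕ.m≤m+n k _)))))
    (sym (shift-below k _ (ℕ.≰⇒> k≰n)))
  ... | yes k≤n with ℕ.m≤n⇒∃[o]m+o≡n k≤n
  ...   | w , refl = trans (beyond w) (sym (shift-at-+ k w _))
  go : ∀ n → sparseConv d e X n ≡ e 0 *ᶻ X n +ᶻ shift d (sparseConv d (tail e) X) n
  go zero    = trans (sparseTerm-≤ d e X 0 z≤n) (sym (ℤ.+-identityʳ _))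
  go (suc n) = trans (∑≤-unfoldˡ n (sparseTerm d e X (suc n)))
                     (cong₂ _+ᶻ_ (sparseTerm-≤ d e X 0 z≤n) (higher n))

sparseConv-dilate : ∀ k e X → sparseConv (suc k) e X ≈ₛ dilate (suc k) e *ₛ X
sparseConv-dilate k e X = shift-recursion-unique (suc k) (λ e → e 0 ·ₛ X)
  (λ e → sparseConv (suc k) e X) (λ e → dilate (suc k) e *ₛ X)
  (λ e → sparseConv-unfold k e X) (λ e → dilate-*ₛ-unfold e X) e

-- (1 - q)⁻ᶜ
negBinomial : ℕ → Series
negBinomial c t = + multisets c t

boundedGF : ℕ → ℕ → ℕ → Series
boundedGF r s m n = + bounded m r s n

boundedGF-zero : ∀ r s → boundedGF r s 0 ≈ₛ 1ₛ
boundedGF-zero r s = coeffwise λ { zero → refl ; (suc n) → refl }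

sumTo-cast : ∀ n f → + sumTo n f ≡ ∑≤ n (λ i → + f i)
sumTo-cast zero    f = refl
sumTo-cast (suc n) f = trans (ℤ.pos-+ (sumTo n f) (f (suc n))) (cong (_+ᶻ + f (suc n)) (sumTo-cast n f))

boundedGF-suc : ∀ r s m →
  boundedGF r s (suc m) ≈ₛ dilate (suc m) (negBinomial (colours r s (suc m))) *ₛ boundedGF r s m
boundedGF-suc r s m = ≈ₛ-trans (coeffwise go) (sparseConv-dilate m E B)
  where
  E = negBinomial (colours r s (suc m))
  B = boundedGF r s m
  term-cast : ∀ n t → + term m r s n t ≡ sparseTerm (suc m) E B n t
  term-cast n t with t * suc m ℕ.≤? n
  ... | yes _ = ℤ.pos-* (multisets (colours r s (suc m)) t) (bounded m r s (n ∸ t * suc m))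
  ... | no  _ = refl
  go : ∀ n → boundedGF r s (suc m) n ≡ sparseConv (suc m) E B n
  go n = trans (sumTo-cast n (term m r s n)) (∑≤-cong n (λ t _ → term-cast n t))

-- Multisets

sumTo-unfoldˡ : ∀ n f → sumTo (suc n) f ≡ f 0 + sumTo n (λ i → f (suc i))
sumTo-unfoldˡ zero    f = refl
sumTo-unfoldˡ (suc n) f = trans (cong (_+ f (2 + n)) (sumTo-unfoldˡ n f)) (ℕ.+-assoc (f 0) _ _)

multisets-zero : ∀ c → multisets c 0 ≡ 1
multisets-zero zero    = refl
multisets-zero (suc c) = multisets-zero c

multisets-pascal : ∀ c t → multisets (suc c) (suc t) ≡ multisets (suc c) t + multisets c (suc t)
multisets-pascal c t =
  trans (sumTo-unfoldˡ t (λ i → multisets c (suc t ∸ i))) (ℕ.+-comm (multisets c (suc t)) _)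

multisets-one : ∀ c → multisets c 1 ≡ c
multisets-one zero    = refl
multisets-one (suc c) =
  trans (multisets-pascal c 0) (cong₂ _+_ (multisets-zero (suc c)) (multisets-one c))

multisets-absorb : ∀ c t → suc t * multisets c (suc t) ≡ c * multisets (suc c) t
multisets-absorb zero    t       = ℕ.*-zeroʳ (suc t)
multisets-absorb (suc c) zero    =
  trans (ℕ.+-identityʳ _) (trans (multisets-one (suc c))
    (sym (trans (cong (suc c *_) (multisets-zero (2 + c))) (ℕ.*-identityʳ (suc c)))))
multisets-absorb (suc c) (suc t) = begin
  (2 + t) * M (suc c) (2 + t)
    ≡⟨ cong ((2 + t) *_) (multisets-pascal c (suc t)) ⟩
  (2 + t) * (M (suc c) (suc t) + M c (2 + t))
    ≡⟨ expand (suc t) (M (suc c) (suc t)) (M c (2 + t)) ⟩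
  suc t * M (suc c) (suc t) + M (suc c) (suc t) + (2 + t) * M c (2 + t)
    ≡⟨ cong₂ (λ x y → x + M (suc c) (suc t) + y) (multisets-absorb (suc c) t) (multisets-absorb c (suc t)) ⟩
  suc c * M (2 + c) t + M (suc c) (suc t) + c * M (suc c) (suc t)
    ≡⟨ collect c (M (2 + c) t) (M (suc c) (suc t)) ⟩
  suc c * (M (2 + c) t + M (suc c) (suc t))
    ≡⟨ cong (suc c *_) (multisets-pascal (suc c) t) ⟨
  suc c * M (2 + c) (suc t) ∎
  where
  open ≡-Reasoning
  M = multisets
  expand : ∀ u x y → suc u * (x + y) ≡ u * x + x + suc u * y
  expand = ℕ-solve-∀
  collect : ∀ c x y → suc c * x + y + c * y ≡ suc c * (x + y)
  collect = ℕ-solve-∀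

p∣multisets : ∀ {p} c t → Prime p → p ∤ t → p ∣ multisets (p * c) t
p∣multisets {p} c zero    _       p∤0 = contradiction (p ∣0) p∤0
p∣multisets {p} c (suc t) p-prime p∤t
  with euclidsLemma (suc t) (multisets (p * c) (suc t)) p-prime
         (subst (p ∣_) (sym (multisets-absorb (p * c) t)) (∣m⇒∣m*n (multisets (suc (p * c)) t) (m∣m*n c)))
... | inj₁ p∣t = contradiction p∣t p∤t
... | inj₂ p∣M = p∣M

1-q^-*ₛ : ∀ e g → (1ₛ -ₛ q^ e) *ₛ g ≈ₛ g -ₛ shift e g
1-q^-*ₛ e g = ≈ₛ-trans (distribʳ g 1ₛ (-ₛ q^ e))
  (+-cong (*-identityˡ g) (≈ₛ-trans (≈ₛ-sym (-‿distribˡ-* (q^ e) g)) (-‿cong (q^-*ₛ e g))))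

negBinomial-pascal : ∀ c → negBinomial c ≈ₛ (1ₛ -ₛ q^ 1) *ₛ negBinomial (suc c)
negBinomial-pascal c = ≈ₛ-trans (coeffwise go) (≈ₛ-sym (1-q^-*ₛ 1 (negBinomial (suc c))))
  where
  M = multisets
  cancel : ∀ x y → x +ᶻ y +ᶻ - x ≡ y
  cancel = solve-∀
  go : ∀ t → negBinomial c t ≡ negBinomial (suc c) t +ᶻ - shift 1 (negBinomial (suc c)) t
  go zero    = trans (cong +_ (trans (multisets-zero c) (sym (multisets-zero (suc c)))))
                     (sym (ℤ.+-identityʳ _))
  go (suc t) = sym (begin
    + M (suc c) (suc t) +ᶻ - + M (suc c) t            ≡⟨ cong (λ m → + m +ᶻ - + M (suc c) t) (multisets-pascal c t) ⟩
    + (M (suc c) t + M c (suc t)) +ᶻ - + M (suc c) t  ≡⟨ cong (_+ᶻ - + M (suc c) t) (ℤ.pos-+ (M (suc c) t) _) ⟩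
    + M (suc c) t +ᶻ + M c (suc t) +ᶻ - + M (suc c) t ≡⟨ cancel (+ M (suc c) t) (+ M c (suc t)) ⟩
    + M c (suc t)                                     ∎)
    where open ≡-Reasoning

-- Series in qᵖ modulo p

-- f ≡ g(qᵖ) (mod p) for some g.
SparseModulo : ℕ → Series → Set
SparseModulo p f = ∀ i → p ∤ i → + p ∣ᶻ f i

∑≤-∣ : ∀ {d} n {f} → (∀ i → i ≤ n → d ∣ᶻ f i) → d ∣ᶻ ∑≤ n f
∑≤-∣ zero    d∣f = d∣f 0 z≤n
∑≤-∣ (suc n) d∣f =
  ℤ∣.∣m∣n⇒∣m+n (∑≤-∣ n (λ i i≤n → d∣f i (ℕ.m≤n⇒m≤1+n i≤n))) (d∣f (suc n) ℕ.≤-refl)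

*ₛ-coeff-∣ : ∀ {d} n f g → (∀ i → i ≤ n → d ∣ᶻ f i *ᶻ g (n ∸ i)) → d ∣ᶻ (f *ₛ g) n
*ₛ-coeff-∣ {d} n f g d∣fg = subst (d ∣ᶻ_) (sym (*ₛ-coeff n f g)) (∑≤-∣ n d∣fg)

module _ {p : ℕ} where

  *ₛ-coeff-∣-sparse : ∀ n {f g} → SparseModulo p f → (∀ i → i ≤ n → p ∣ i → + p ∣ᶻ g (n ∸ i)) →
                      + p ∣ᶻ (f *ₛ g) n
  *ₛ-coeff-∣-sparse n {f} {g} f-sparse g-divisible = *ₛ-coeff-∣ n f g convolution-term
    where
    convolution-term : ∀ i → i ≤ n → + p ∣ᶻ f i *ᶻ g (n ∸ i)
    convolution-term i i≤n with p ∣? i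
    ... | no  p∤i = ℤ∣.∣m⇒∣m*n (g (n ∸ i)) (f-sparse i p∤i)
    ... | yes p∣i = ℤ∣.∣n⇒∣m*n (f i) (g-divisible i i≤n p∣i)

  sparse-1ₛ : SparseModulo p 1ₛ
  sparse-1ₛ zero    p∤0 = contradiction (p ∣0) p∤0
  sparse-1ₛ (suc i) _   = ℤ∣.∣ᵤ⇒∣ (p ∣0)

  sparse-*ₛ : ∀ {f g} → SparseModulo p f → SparseModulo p g → SparseModulo p (f *ₛ g)
  sparse-*ₛ f-sparse g-sparse n p∤n = *ₛ-coeff-∣-sparse n f-sparse (λ i i≤n p∣i →
    g-sparse (n ∸ i) (λ p∣n-i → p∤n (subst (p ∣_) (ℕ.m+[n∸m]≡n i≤n) (∣m∣n⇒∣m+n p∣i p∣n-i))))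

  sparse-dilate : ∀ d {f} → SparseModulo p f → SparseModulo p (dilate d f)
  sparse-dilate d {f} f-sparse n p∤n with d ∣? n
  ... | yes (divides t n≡td) = f-sparse t (λ p∣t → p∤n (subst (p ∣_) (sym n≡td) (∣m⇒∣m*n d p∣t)))
  ... | no  _                = ℤ∣.∣ᵤ⇒∣ (p ∣0)

  sparse-negBinomial : ∀ c → Prime p → SparseModulo p (negBinomial (p * c))
  sparse-negBinomial c p-prime t p∤t = ℤ∣.∣ᵤ⇒∣ (p∣multisets c t p-prime p∤t)

-- Shanks' identity and Euler's pentagonal number theorem

open FiniteSum (CommutativeRing.+-commutativeMonoid series-commutativeRing) using ()
  renaming (∑≤ to ∑ₛ≤)

∑ₛ≤-coeff : ∀ m h n → ∑ₛ≤ m h n ≡ ∑≤ m (λ k → h k n)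
∑ₛ≤-coeff zero    h n = refl
∑ₛ≤-coeff (suc m) h n = cong (_+ᶻ h (suc m) n) (∑ₛ≤-coeff m h n)

∑ₛ≤-telescope : ∀ m {a b} (c : ℕ → Series) → (∀ k → k ≤ m → a k ≈ₛ b k +ₛ (c (suc k) -ₛ c k)) →
  ∑ₛ≤ m a ≈ₛ ∑ₛ≤ m b +ₛ (c (suc m) -ₛ c 0)
∑ₛ≤-telescope zero    c a≈ = a≈ 0 z≤n
∑ₛ≤-telescope (suc m) {a} {b} c a≈ = begin
  ∑ₛ≤ m a +ₛ a (suc m)
    ≈⟨ +-cong (∑ₛ≤-telescope m c (λ k k≤m → a≈ k (ℕ.m≤n⇒m≤1+n k≤m))) (a≈ (suc m) ℕ.≤-refl) ⟩
  (∑ₛ≤ m b +ₛ (c (suc m) -ₛ c 0)) +ₛ (b (suc m) +ₛ (c (2 + m) -ₛ c (suc m)))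
    ≈⟨ solve 5 (λ B c₁ c₀ b c₂ → ((B :+ (c₁ :- c₀)) :+ (b :+ (c₂ :- c₁))) := ((B :+ b) :+ (c₂ :- c₀)))
         ≈ₛ-refl (∑ₛ≤ m b) (c (suc m)) (c 0) (b (suc m)) (c (2 + m)) ⟩
  ∑ₛ≤ m b +ₛ b (suc m) +ₛ (c (2 + m) -ₛ c 0) ∎
  where open ≈ₛ-Reasoning

x*[1-y]≈x-x*y : ∀ x y → x *ₛ (1ₛ -ₛ y) ≈ₛ x -ₛ x *ₛ y
x*[1-y]≈x-x*y x y =
  ≈ₛ-trans (distribˡ x 1ₛ (-ₛ y)) (+-cong (*-identityʳ x) (≈ₛ-sym (-‿distribʳ-* x y)))

q^-split : ∀ {e} a b → e ≡ a + b → q^ e ≈ₛ q^ a *ₛ q^ b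
q^-split a b refl = ≈ₛ-sym (q^-+ a b)

sign : ℕ → Series
sign k = constₛ (-1ℤ ℤ.^ k)

sign-suc : ∀ k → sign (suc k) ≈ₛ -ₛ sign k
sign-suc k = coeffwise (λ n → trans (ℤ.*-assoc -1ℤ (-1ℤ ℤ.^ k) (1ₛ n)) (ℤ.-1*i≡-i _))

sign-zero-*ₛ : ∀ f → sign 0 *ₛ f ≈ₛ f
sign-zero-*ₛ f = coeffwise (λ n → trans (*ₛ-constˡ-at n 1ℤ f) (ℤ.*-identityˡ (f n)))

triangular : ℕ → ℕ
triangular zero    = 0
triangular (suc k) = triangular k + suc k

poch : ℕ → ℕ → Series
poch k zero    = 1ₛ
poch k (suc j) = (1ₛ -ₛ q^ suc k) *ₛ poch (suc k) j

poch-snoc : ∀ k j → poch k (suc j) ≈ₛ poch k j *ₛ (1ₛ -ₛ q^ suc (k + j))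
poch-snoc k zero    = ≈ₛ-trans (*-comm _ 1ₛ)
  (≈ₛ-reflexive (cong (λ e → 1ₛ *ₛ (1ₛ -ₛ q^ suc e)) (sym (ℕ.+-identityʳ k))))
poch-snoc k (suc j) = begin
  (1ₛ -ₛ q^ suc k) *ₛ poch (suc k) (suc j)                          ≈⟨ *-cong ≈ₛ-refl (poch-snoc (suc k) j) ⟩
  (1ₛ -ₛ q^ suc k) *ₛ (poch (suc k) j *ₛ (1ₛ -ₛ q^ (2 + k + j)))   ≈⟨ ≈ₛ-sym (*-assoc _ _ _) ⟩
  poch k (suc j) *ₛ (1ₛ -ₛ q^ (2 + k + j))                          ≡⟨ cong (λ e → poch k (suc j) *ₛ (1ₛ -ₛ q^ suc e))
                                                                            (sym (ℕ.+-suc k j)) ⟩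
  poch k (suc j) *ₛ (1ₛ -ₛ q^ suc (k + suc j))                      ∎
  where open ≈ₛ-Reasoning

-- From n to n + 1 the k-th term of Shanks' sum changes by shanksDiff n (k + 1) - shanksDiff n k,
-- so the sums telescope.
shanksTerm : ℕ → ℕ → Series
shanksTerm n k = sign k *ₛ q^ (n * k + triangular k) *ₛ poch k (n ∸ k)

shanksDiff : ℕ → ℕ → Series
shanksDiff n zero    = 0ₛ
shanksDiff n (suc k) = sign (suc k) *ₛ q^ (n * suc k + triangular (suc k)) *ₛ poch k (n ∸ k)

-- the exponents (3j ∓ 1) j / 2 for j = n + 1
pentagonal₋ pentagonal₊ : ℕ → ℕ
pentagonal₋ n = suc n * suc n + triangular n
pentagonal₊ n = suc n * suc n + triangular (suc n)

pentagonalSum : ℕ → Series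
pentagonalSum zero    = 1ₛ
pentagonalSum (suc n) = pentagonalSum n +ₛ sign (suc n) *ₛ (q^ pentagonal₋ n +ₛ q^ pentagonal₊ n)

shanksDiff-≤ : ∀ {n} k → k ≤ n →
  shanksDiff n k ≈ₛ sign k *ₛ q^ (n * k + triangular k) *ₛ (poch k (n ∸ k) -ₛ q^ k *ₛ poch k (n ∸ k))
shanksDiff-≤ {n} zero    _   = ≈ₛ-sym (≈ₛ-trans (*-cong ≈ₛ-refl P-P≈0) (zeroʳ (sign 0 *ₛ q^ (n * 0 + 0))))
  where
  P = poch 0 n
  P-P≈0 : P -ₛ q^ 0 *ₛ P ≈ₛ 0ₛ
  P-P≈0 = ≈ₛ-trans (+-cong (≈ₛ-refl {P}) (-‿cong (*-identityˡ P))) (-‿inverseʳ P)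
shanksDiff-≤ {n} (suc k) k≤n = *-cong ≈ₛ-refl (begin
  poch k (n ∸ k)              ≡⟨ cong (poch k) (ℕ.+-∸-assoc 1 k≤n) ⟩
  (1ₛ -ₛ q^ suc k) *ₛ P       ≈⟨ ≈ₛ-trans (*-comm _ P) (x*[1-y]≈x-x*y P _) ⟩
  P -ₛ P *ₛ q^ suc k          ≈⟨ +-cong (≈ₛ-refl {P}) (-‿cong (*-comm P _)) ⟩
  P -ₛ q^ suc k *ₛ P          ∎)
  where
  open ≈ₛ-Reasoning
  P = poch (suc k) (n ∸ suc k)

module _ {n k : ℕ} (k≤n : k ≤ n) where
  private
    E Q X P : Series
    E = q^ (n * k + triangular k)
    Q = q^ k
    X = q^ suc n
    P = poch k (n ∸ k)

  shanksTerm-suc : shanksTerm (suc n) k ≈ₛ sign k *ₛ (E *ₛ Q) *ₛ (P -ₛ P *ₛ X)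
  shanksTerm-suc = *-cong (*-cong ≈ₛ-refl (q^-split (n * k + triangular k) k (exponent n k (triangular k))))
    (begin
      poch k (suc n ∸ k)                   ≡⟨ cong (poch k) (ℕ.+-∸-assoc 1 k≤n) ⟩
      poch k (suc (n ∸ k))                 ≈⟨ poch-snoc k (n ∸ k) ⟩
      P *ₛ (1ₛ -ₛ q^ suc (k + (n ∸ k)))   ≡⟨ cong (λ e → P *ₛ (1ₛ -ₛ q^ suc e)) (ℕ.m+[n∸m]≡n k≤n) ⟩
      P *ₛ (1ₛ -ₛ X)                       ≈⟨ x*[1-y]≈x-x*y P X ⟩
      P -ₛ P *ₛ X                          ∎)
    where
    open ≈ₛ-Reasoning
    exponent : ∀ n k t → suc n * k + t ≡ (n * k + t) + k
    exponent = ℕ-solve-∀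

  shanksDiff-suc : shanksDiff n (suc k) ≈ₛ -ₛ (sign k *ₛ (E *ₛ Q *ₛ X) *ₛ P)
  shanksDiff-suc = begin
    sign (suc k) *ₛ q^ (n * suc k + triangular (suc k)) *ₛ P
      ≈⟨ *-cong (*-cong (sign-suc k) E*Q*X) ≈ₛ-refl ⟩
    -ₛ sign k *ₛ (E *ₛ Q *ₛ X) *ₛ P
      ≈⟨ solve 3 (λ s y P → ((:- s) :* y :* P) := (:- (s :* y :* P))) ≈ₛ-refl (sign k) (E *ₛ Q *ₛ X) P ⟩
    -ₛ (sign k *ₛ (E *ₛ Q *ₛ X) *ₛ P) ∎
    where
    open ≈ₛ-Reasoning
    exponent : ∀ n k t → n * suc k + (t + suc k) ≡ ((n * k + t) + k) + suc n
    exponent = ℕ-solve-∀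
    E*Q*X : q^ (n * suc k + triangular (suc k)) ≈ₛ E *ₛ Q *ₛ X
    E*Q*X = ≈ₛ-trans (q^-split (n * k + triangular k + k) (suc n) (exponent n k (triangular k)))
                     (*-cong (q^-split (n * k + triangular k) k refl) ≈ₛ-refl)

  shanksTerm-step : shanksTerm (suc n) k ≈ₛ shanksTerm n k +ₛ (shanksDiff n (suc k) -ₛ shanksDiff n k)
  shanksTerm-step = begin
    shanksTerm (suc n) k
      ≈⟨ shanksTerm-suc ⟩
    s *ₛ (E *ₛ Q) *ₛ (P -ₛ P *ₛ X)
      ≈⟨ solve 5 (λ s E Q X P → (s :* (E :* Q) :* (P :- P :* X))
                               := (s :* E :* P :+ ((:- (s :* (E :* Q :* X) :* P)) :- s :* E :* (P :- Q :* P))))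
           ≈ₛ-refl s E Q X P ⟩
    s *ₛ E *ₛ P +ₛ (-ₛ (s *ₛ (E *ₛ Q *ₛ X) *ₛ P) -ₛ s *ₛ E *ₛ (P -ₛ Q *ₛ P))
      ≈⟨ +-cong (≈ₛ-refl {shanksTerm n k})
                (+-cong (≈ₛ-sym shanksDiff-suc) (-‿cong (≈ₛ-sym (shanksDiff-≤ k k≤n)))) ⟩
    shanksTerm n k +ₛ (shanksDiff n (suc k) -ₛ shanksDiff n k) ∎
    where
    open ≈ₛ-Reasoning
    s = sign k

shanks : ∀ n → ∑ₛ≤ n (shanksTerm n) ≈ₛ pentagonalSum n
shanks zero    = ≈ₛ-trans (*-identityʳ _) (sign-zero-*ₛ 1ₛ)
shanks (suc n) = begin
  ∑ₛ≤ n (shanksTerm (suc n)) +ₛ shanksTerm (suc n) (suc n)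
    ≈⟨ +-cong (∑ₛ≤-telescope n (shanksDiff n) (λ k k≤n → shanksTerm-step k≤n)) ≈ₛ-refl ⟩
  ∑ₛ≤ n (shanksTerm n) +ₛ (shanksDiff n (suc n) -ₛ 0ₛ) +ₛ shanksTerm (suc n) (suc n)
    ≈⟨ +-cong (+-cong (shanks n) (≈ₛ-trans (x-0≈x _) last-diff)) last-term ⟩
  pentagonalSum n +ₛ s *ₛ q^ pentagonal₋ n +ₛ s *ₛ q^ pentagonal₊ n
    ≈⟨ solve 4 (λ T s x y → (T :+ s :* x :+ s :* y) := (T :+ s :* (x :+ y)))
         ≈ₛ-refl (pentagonalSum n) s (q^ pentagonal₋ n) (q^ pentagonal₊ n) ⟩
  pentagonalSum (suc n) ∎
  where
  open ≈ₛ-Reasoning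
  s = sign (suc n)
  x-0≈x : ∀ x → x -ₛ 0ₛ ≈ₛ x
  x-0≈x x = coeffwise (λ d → ℤ.+-identityʳ (x d))
  poch-n∸n : ∀ k → poch k (n ∸ n) ≈ₛ 1ₛ
  poch-n∸n k = ≈ₛ-reflexive (cong (poch k) (ℕ.n∸n≡0 n))
  exponent : ∀ n t → n * suc n + (t + suc n) ≡ suc n * suc n + t
  exponent = ℕ-solve-∀
  last-diff : shanksDiff n (suc n) ≈ₛ s *ₛ q^ pentagonal₋ n
  last-diff = ≈ₛ-trans (*-cong (*-cong ≈ₛ-refl (≈ₛ-reflexive (cong q^_ (exponent n (triangular n)))))
                               (poch-n∸n n))
                       (*-identityʳ _)
  last-term : shanksTerm (suc n) (suc n) ≈ₛ s *ₛ q^ pentagonal₊ n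
  last-term = ≈ₛ-trans (*-cong ≈ₛ-refl (poch-n∸n (suc n))) (*-identityʳ _)

triangular-double : ∀ n → 2 * triangular n ≡ n * suc n
triangular-double zero    = refl
triangular-double (suc n) = begin
  2 * (triangular n + suc n)       ≡⟨ ℕ.*-distribˡ-+ 2 (triangular n) (suc n) ⟩
  2 * triangular n + 2 * suc n     ≡⟨ cong (_+ 2 * suc n) (triangular-double n) ⟩
  n * suc n + 2 * suc n            ≡⟨ expand n ⟩
  suc n * suc (suc n)              ∎
  where
  open ≡-Reasoning
  expand : ∀ n → n * suc n + 2 * suc n ≡ suc n * suc (suc n)
  expand = ℕ-solve-∀

pentagonal₋-square : ∀ n → 24 * pentagonal₋ n + 1 ≡ (6 * n + 5) * (6 * n + 5)
pentagonal₋-square n = trans (expand (suc n * suc n) (triangular n))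
  (trans (cong (λ t → 24 * (suc n * suc n) + 12 * t + 1) (triangular-double n)) (square n))
  where
  expand : ∀ x t → 24 * (x + t) + 1 ≡ 24 * x + 12 * (2 * t) + 1
  expand = ℕ-solve-∀
  square : ∀ n → 24 * (suc n * suc n) + 12 * (n * suc n) + 1 ≡ (6 * n + 5) * (6 * n + 5)
  square = ℕ-solve-∀

pentagonal₊-square : ∀ n → 24 * pentagonal₊ n + 1 ≡ (6 * n + 7) * (6 * n + 7)
pentagonal₊-square n = trans (expand (suc n * suc n) (triangular (suc n)))
  (trans (cong (λ t → 24 * (suc n * suc n) + 12 * t + 1) (triangular-double (suc n))) (square n))
  where
  expand : ∀ x t → 24 * (x + t) + 1 ≡ 24 * x + 12 * (2 * t) + 1
  expand = ℕ-solve-∀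
  square : ∀ n → 24 * (suc n * suc n) + 12 * (suc n * suc (suc n)) + 1 ≡ (6 * n + 7) * (6 * n + 7)
  square = ℕ-solve-∀

pentagonalSum-gap : ∀ n {d} → (∀ y → y * y ≢ 24 * d + 1) → pentagonalSum n d ≡ 0ℤ
pentagonalSum-gap zero    {zero}  not-square = contradiction refl (not-square 1)
pentagonalSum-gap zero    {suc d} not-square = refl
pentagonalSum-gap (suc n) {d}     not-square = begin
  pentagonalSum n d +ᶻ (sign (suc n) *ₛ (q^ pentagonal₋ n +ₛ q^ pentagonal₊ n)) d
    ≡⟨ cong₂ _+ᶻ_ (pentagonalSum-gap n not-square) (*ₛ-constˡ-at d σ _) ⟩
  0ℤ +ᶻ σ *ᶻ ((q^ pentagonal₋ n) d +ᶻ (q^ pentagonal₊ n) d)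
    ≡⟨ cong (λ x → 0ℤ +ᶻ σ *ᶻ x)
         (cong₂ _+ᶻ_ (q^-≢ (off-square (pentagonal₋ n) (6 * n + 5) (pentagonal₋-square n)))
                     (q^-≢ (off-square (pentagonal₊ n) (6 * n + 7) (pentagonal₊-square n)))) ⟩
  0ℤ +ᶻ σ *ᶻ 0ℤ
    ≡⟨ cong (0ℤ +ᶻ_) (ℤ.*-zeroʳ σ) ⟩
  0ℤ ∎
  where
  open ≡-Reasoning
  σ = -1ℤ ℤ.^ suc n
  off-square : ∀ e y → 24 * e + 1 ≡ y * y → e ≢ d
  off-square e y sq e≡d = not-square y (sym (trans (cong (λ e → 24 * e + 1) (sym e≡d)) sq))

shanksTerm-zero : ∀ n → shanksTerm n 0 ≈ₛ poch 0 n
shanksTerm-zero n =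
  ≈ₛ-trans (*-cong (≈ₛ-trans (sign-zero-*ₛ _) (≈ₛ-reflexive (cong q^_ exponent))) ≈ₛ-refl) (*-identityˡ _)
  where
  exponent : n * 0 + 0 ≡ 0
  exponent = trans (ℕ.+-identityʳ (n * 0)) (ℕ.*-zeroʳ n)

shanksTerm-low : ∀ n k {d} → d ≤ n → shanksTerm n (suc k) d ≡ 0ℤ
shanksTerm-low n k {d} d≤n = trans (coeff reorder d) (q^-*ₛ-below e _ (ℕ.≤-<-trans d≤n n<e))
  where
  e = n * suc k + triangular (suc k)
  reorder : shanksTerm n (suc k) ≈ₛ q^ e *ₛ (sign (suc k) *ₛ poch (suc k) (n ∸ suc k))
  reorder = solve 3 (λ s x P → (s :* x :* P) := (x :* (s :* P))) ≈ₛ-refl _ _ _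
  n<e : n < e
  n<e = begin-strict
    n                                     <⟨ s≤s (ℕ.m≤m+n n k) ⟩
    suc (n + k)                           ≡⟨ ℕ.+-suc n k ⟨
    n + suc k                             ≤⟨ ℕ.+-mono-≤ (ℕ.m≤m*n n (suc k))
                                                         (ℕ.m≤n+m (suc k) (triangular k)) ⟩
    n * suc k + (triangular k + suc k)    ∎
    where open ℕ.≤-Reasoning

-- Euler's pentagonal number theorem for (q; q)_n, which is exact below degree n + 1.
euler-gap : ∀ n {d} → d ≤ n → (∀ y → y * y ≢ 24 * d + 1) → poch 0 n d ≡ 0ℤ
euler-gap n {d} d≤n not-square = begin
  poch 0 n d                 ≡⟨ coeff (shanksTerm-zero n) d ⟨
  shanksTerm n 0 d           ≡⟨ only-first-term n ⟨
  ∑ₛ≤ n (shanksTerm n) d     ≡⟨ coeff (shanks n) d ⟩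
  pentagonalSum n d          ≡⟨ pentagonalSum-gap n not-square ⟩
  0ℤ                         ∎
  where
  open ≡-Reasoning
  only-first-term : ∀ m → ∑ₛ≤ m (shanksTerm n) d ≡ shanksTerm n 0 d
  only-first-term zero    = refl
  only-first-term (suc m) = begin
    ∑ₛ≤ (suc m) (shanksTerm n) d                             ≡⟨ ∑ₛ≤-coeff (suc m) (shanksTerm n) d ⟩
    ∑≤ (suc m) (λ k → shanksTerm n k d)                      ≡⟨ ∑≤-unfoldˡ m _ ⟩
    shanksTerm n 0 d +ᶻ ∑≤ m (λ k → shanksTerm n (suc k) d)  ≡⟨ cong (shanksTerm n 0 d +ᶻ_)
                                                                  (∑≤-ε m (λ k _ → shanksTerm-low n k d≤n)) ⟩
    shanksTerm n 0 d +ᶻ 0ℤ                                   ≡⟨ ℤ.+-identityʳ _ ⟩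
    shanksTerm n 0 d                                         ∎

even-euler-gap : ∀ L {e} → e < suc L * 2 → (∀ y → y * y ≢ 12 * e + 1) → dilate 2 (poch 0 L) e ≡ 0ℤ
even-euler-gap L {e} e<2L+2 not-square = by-cases (2 ∣? e)
  where
  double : ∀ t → 24 * t + 1 ≡ 12 * (t * 2) + 1
  double = ℕ-solve-∀
  by-cases : Dec (2 ∣ e) → dilate 2 (poch 0 L) e ≡ 0ℤ
  by-cases (no 2∤e) = dilate-∤ (poch 0 L) 2∤e
  by-cases (yes (divides t e≡2t)) = begin
    dilate 2 (poch 0 L) e        ≡⟨ cong (dilate 2 (poch 0 L)) e≡2t ⟩
    dilate 2 (poch 0 L) (t * 2)  ≡⟨ dilate-∣ (poch 0 L) t ⟩
    poch 0 L t                   ≡⟨ euler-gap L t≤L (λ y y²≡ → not-square y (begin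
                                      y * y           ≡⟨ y²≡ ⟩
                                      24 * t + 1      ≡⟨ double t ⟩
                                      12 * (t * 2) + 1 ≡⟨ cong (λ m → 12 * m + 1) e≡2t ⟨
                                      12 * e + 1      ∎)) ⟩
    0ℤ                           ∎
    where
    open ≡-Reasoning
    t≤L : t ≤ L
    t≤L = ℕ.≤-pred (ℕ.*-cancelʳ-< 2 t (suc L) (subst (_< suc L * 2) e≡2t e<2L+2))

-- Factorisation of the generating function

colours-even : ∀ r s m → m % 2 ≡ 0 → colours r s m ≡ r
colours-even r s m m%2≡0 with m % 2 | m%2≡0
... | zero | _ = refl

colours-odd : ∀ r s m → m % 2 ≡ 1 → colours r s m ≡ s
colours-odd r s m m%2≡1 with m % 2 | m%2≡1
... | suc _ | _ = refl

half-split : ∀ N → Σ[ L ∈ ℕ ] (N ≡ L * 2 ⊎ N ≡ suc (L * 2))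
half-split zero = 0 , inj₁ refl
half-split (suc N) with half-split N
... | L , inj₁ N≡2L   = L , inj₂ (cong suc N≡2L)
... | L , inj₂ N≡2L+1 = suc L , inj₁ (cong suc N≡2L+1)

module _ {p r s α β : ℕ} (p-prime : Prime p) (r+1≡pα : suc r ≡ p * α) (s≡pβ : s ≡ p * β) where

  Factorisation : ℕ → ℕ → Set
  Factorisation m L = Σ[ G ∈ Series ] SparseModulo p G × boundedGF r s m ≈ₛ G *ₛ dilate 2 (poch 0 L)

  with-odd-part : ∀ L → Factorisation (L * 2) L → Factorisation (suc (L * 2)) L
  with-odd-part L (G , G-sparse , B≈GF) =
    D *ₛ G , sparse-*ₛ (sparse-dilate d (sparse-negBinomial β p-prime)) G-sparse , (begin
      boundedGF r s d                                                   ≈⟨ boundedGF-suc r s (L * 2) ⟩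
      dilate d (negBinomial (colours r s d)) *ₛ boundedGF r s (L * 2)   ≈⟨ *-cong D≈ B≈GF ⟩
      D *ₛ (G *ₛ F)                                                     ≈⟨ *-assoc D G F ⟨
      D *ₛ G *ₛ F                                                       ∎)
    where
    open ≈ₛ-Reasoning
    d = suc (L * 2)
    D = dilate d (negBinomial (p * β))
    F = dilate 2 (poch 0 L)
    D≈ : dilate d (negBinomial (colours r s d)) ≈ₛ D
    D≈ = ≈ₛ-reflexive (cong (λ c → dilate d (negBinomial c))
                            (trans (colours-odd r s d ([m+kn]%n≡m%n 1 L 2)) s≡pβ))

  with-even-part : ∀ L → Factorisation (suc (L * 2)) L → Factorisation (suc L * 2) (suc L)
  with-even-part L (G , G-sparse , B≈GF) =
    D *ₛ G , sparse-*ₛ (sparse-dilate d (sparse-negBinomial α p-prime)) G-sparse , (begin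
      boundedGF r s d
        ≈⟨ boundedGF-suc r s (suc (L * 2)) ⟩
      dilate d (negBinomial (colours r s d)) *ₛ boundedGF r s (suc (L * 2))
        ≈⟨ *-cong (≈ₛ-reflexive (cong (λ c → dilate d (negBinomial c)) colours≡r)) B≈GF ⟩
      dilate d (negBinomial r) *ₛ (G *ₛ F)
        ≈⟨ *-cong (≈ₛ-trans (dilate-cong (negBinomial-pascal r)) (dilate-*ₛ _ _)) ≈ₛ-refl ⟩
      dilate d (1ₛ -ₛ q^ 1) *ₛ dilate d (negBinomial (suc r)) *ₛ (G *ₛ F)
        ≈⟨ *-cong (*-cong factor≈ D≈) ≈ₛ-refl ⟩
      (1ₛ -ₛ q^ d) *ₛ D *ₛ (G *ₛ F)
        ≈⟨ solve 4 (λ x D G F → (x :* D :* (G :* F)) := (D :* G :* (F :* x))) ≈ₛ-refl (1ₛ -ₛ q^ d) D G F ⟩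
      D *ₛ G *ₛ (F *ₛ (1ₛ -ₛ q^ d))
        ≈⟨ *-cong ≈ₛ-refl (≈ₛ-sym F-step) ⟩
      D *ₛ G *ₛ dilate 2 (poch 0 (suc L)) ∎)
    where
    open ≈ₛ-Reasoning
    d = suc L * 2
    D = dilate d (negBinomial (p * α))
    F = dilate 2 (poch 0 L)
    colours≡r : colours r s d ≡ r
    colours≡r = colours-even r s d (m*n%n≡0 (suc L) 2)
    factor≈ : dilate d (1ₛ -ₛ q^ 1) ≈ₛ 1ₛ -ₛ q^ d
    factor≈ = ≈ₛ-trans (dilate-1-q^ 1) (≈ₛ-reflexive (cong (λ e → 1ₛ -ₛ q^ e) (ℕ.*-identityˡ d)))
    D≈ : dilate d (negBinomial (suc r)) ≈ₛ D
    D≈ = ≈ₛ-reflexive (cong (λ c → dilate d (negBinomial c)) r+1≡pα)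
    F-step : dilate 2 (poch 0 (suc L)) ≈ₛ F *ₛ (1ₛ -ₛ q^ d)
    F-step = ≈ₛ-trans (dilate-cong (poch-snoc 0 L))
                      (≈ₛ-trans (dilate-*ₛ _ _) (*-cong ≈ₛ-refl (dilate-1-q^ (suc L))))

  factorisation : ∀ L → Factorisation (L * 2) L
  factorisation zero    =
    1ₛ , sparse-1ₛ , ≈ₛ-trans (boundedGF-zero r s) (≈ₛ-sym (≈ₛ-trans (*-identityˡ _) (dilate-q^ 0)))
  factorisation (suc L) = with-even-part L (with-odd-part L (factorisation L))

  factorisation-divisible : ∀ N L → N < suc L * 2 → Factorisation N L →
    (∀ i → i ≤ N → p ∣ i → ∀ y → y * y ≢ 12 * (N ∸ i) + 1) → + p ∣ᶻ boundedGF r s N N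
  factorisation-divisible N L N<2L+2 (G , G-sparse , B≈GF) not-square =
    subst (+ p ∣ᶻ_) (sym (coeff B≈GF N)) (*ₛ-coeff-∣-sparse N G-sparse (λ i i≤N p∣i →
      subst (+ p ∣ᶻ_) (sym (even-euler-gap L (ℕ.≤-<-trans (ℕ.m∸n≤m N i) N<2L+2) (not-square i i≤N p∣i)))
            (ℤ∣.∣ᵤ⇒∣ (p ∣0))))

  boundedGF-divisible : ∀ N → (∀ i → i ≤ N → p ∣ i → ∀ y → y * y ≢ 12 * (N ∸ i) + 1) →
                        + p ∣ᶻ boundedGF r s N N
  boundedGF-divisible N with half-split N
  ... | L , inj₁ refl = factorisation-divisible (L * 2) L (s≤s (ℕ.n≤1+n (L * 2))) (factorisation L)
  ... | L , inj₂ refl =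
    factorisation-divisible (suc (L * 2)) L (ℕ.n<1+n _) (with-odd-part L (factorisation L))

residue-of-12e+1 : ∀ p .{{_ : NonZero p}} n r e c → e + c * p ≡ p * n + r →
                   (12 * e + 1) % p ≡ (12 * r + 1) % p
residue-of-12e+1 p n r e c e+cp≡N = begin
  (12 * e + 1) % p                 ≡⟨ [m+kn]%n≡m%n (12 * e + 1) (12 * c) p ⟨
  (12 * e + 1 + 12 * c * p) % p    ≡⟨ cong (_% p) (regroup e c p) ⟩
  (12 * (e + c * p) + 1) % p       ≡⟨ cong (λ m → (12 * m + 1) % p) e+cp≡N ⟩
  (12 * (p * n + r) + 1) % p       ≡⟨ cong (_% p) (spread n r p) ⟩
  (12 * r + 1 + 12 * n * p) % p    ≡⟨ [m+kn]%n≡m%n (12 * r + 1) (12 * n) p ⟩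
  (12 * r + 1) % p                 ∎
  where
  open ≡-Reasoning
  regroup : ∀ e c p → 12 * e + 1 + 12 * c * p ≡ 12 * (e + c * p) + 1
  regroup = ℕ-solve-∀
  spread : ∀ n r p → 12 * (p * n + r) + 1 ≡ 12 * r + 1 + 12 * n * p
  spread = ℕ-solve-∀

theorem1p16 : (p : ℕ) → .{{_ : NonZero p}} → Prime p → 5 ≤ p →
    (r : ℕ) → 1 ≤ r → r ≤ p ∸ 1 → QuadNonResidue p (12 * r + 1) →
    (n k j : ℕ) → j ≤ k →
    p ∣ a (p * (k ∸ j) + (p ∸ 1)) (p * k + p) (p * n + r)
theorem1p16 p p-prime _ r _ _ (_ , nonresidue) n k j _ =
  ℤ∣.∣⇒∣ᵤ (boundedGF-divisible p-prime r+1≡pα s≡pβ (p * n + r) not-square)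
  where
  r+1≡pα : suc (p * (k ∸ j) + (p ∸ 1)) ≡ p * suc (k ∸ j)
  r+1≡pα = begin
    suc (p * (k ∸ j) + (p ∸ 1))   ≡⟨ ℕ.+-suc (p * (k ∸ j)) (p ∸ 1) ⟨
    p * (k ∸ j) + suc (p ∸ 1)     ≡⟨ cong (λ m → p * (k ∸ j) + m) (ℕ.m+[n∸m]≡n (>-nonZero⁻¹ p)) ⟩
    p * (k ∸ j) + p               ≡⟨ ℕ.+-comm (p * (k ∸ j)) p ⟩
    p + p * (k ∸ j)               ≡⟨ ℕ.*-suc p (k ∸ j) ⟨
    p * suc (k ∸ j)               ∎
    where open ≡-Reasoning
  s≡pβ : p * k + p ≡ p * suc k
  s≡pβ = trans (ℕ.+-comm (p * k) p) (sym (ℕ.*-suc p k))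
  not-square : ∀ i → i ≤ p * n + r → p ∣ i → ∀ y → y * y ≢ 12 * (p * n + r ∸ i) + 1
  not-square i i≤N (divides c i≡cp) y y²≡ = nonresidue y (trans (cong (_% p) y²≡)
    (residue-of-12e+1 p n r (p * n + r ∸ i) c
      (trans (cong (λ m → p * n + r ∸ i + m) (sym i≡cp)) (ℕ.m∸n+n≡m i≤N))))
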